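{- Let $\hat A$ and $\hat B$ be change actions with $\hat B$ continuous, let $I$ be a directed set, and let $(f_i)_{i\in I}$ and $(\partial f_i)_{i\in I}$ be $I$-indexed directed families of functions $A\to B$ and $A\times\Delta A\to\Delta B$ respectively (ordered pointwise). If $\partial f_i$ is a derivative of $f_i$ for every $i\in I$, then $\bigsqcup_{i\in I}\partial f_i$ is a derivative of $\bigsqcup_{i\in I}f_i$ (least upper bounds taken pointwise).
   Context: A change action $\hat A=(A,\Delta A,\oplus,+,0)$ is a set $A$, a monoid $(\Delta A,+,0)$ and a monoid action $\oplus:A\times\Delta A\to A$ ($a\oplus 0=a$, $a\oplus(\delta_1+\delta_2)=(a\oplus\delta_1)\oplus\delta_2$). A derivative of $f:A\to B$ is $\partial f:A\times\Delta A\to\Delta B$ with $f(a\oplus_A\delta)=f(a)\oplus_B\partial f(a,\delta)$. A change action $\hat B$ is continuous if $B$ and $\Delta B$ are directed-complete partial orders (every non-empty directed subset has a least upper bound) and $\oplus_B:B\times\Delta B\to B$ and $+_B$ are continuous (monotone and preserving directed suprema). An $I$-indexed directed family means a family indexed by a directed set $I$ that is monotone in the index ($i\le j$ implies $f_i\le f_j$ and $\partial f_i\le\partial f_j$ pointwise). -}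

module Defs where

open import Data.Product using (Σ; _×_; _,_; proj₁; proj₂)
open import Relation.Binary.PropositionalEquality using (_≡_)
open import Relation.Binary.Structures using (IsPartialOrder)

record ChangeAction : Set₁ where
  infixl 6 _⊕_
  infixl 7 _+_
  field
    Obj   : Set
    Δ     : Set
    _+_   : Δ → Δ → Δ
    𝟘     : Δ
    +-assoc     : ∀ x y z → (x + y) + z ≡ x + (y + z)
    +-identityˡ : ∀ x → 𝟘 + x ≡ x
    +-identityʳ : ∀ x → x + 𝟘 ≡ x
    _⊕_   : Obj → Δ → Obj
    ⊕-identity : ∀ a → a ⊕ 𝟘 ≡ a
    ⊕-act      : ∀ a d₁ d₂ → a ⊕ (d₁ + d₂) ≡ (a ⊕ d₁) ⊕ d₂

open ChangeAction public using (Obj; Δ)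

IsDerivative : (A B : ChangeAction) → (Obj A → Obj B) → (Obj A → Δ A → Δ B) → Set
IsDerivative A B f ∂f =
  ∀ a δ → f (ChangeAction._⊕_ A a δ) ≡ ChangeAction._⊕_ B (f a) (∂f a δ)

IsDirectedFam : {X : Set} → (X → X → Set) → {J : Set} → (J → X) → Set
IsDirectedFam {X} _≤_ {J} x =
  J × (∀ j k → Σ J λ l → (x j ≤ x l) × (x k ≤ x l))

IsLub : {X : Set} → (X → X → Set) → {J : Set} → (J → X) → X → Set
IsLub _≤_ {J} x u =
  (∀ j → x j ≤ u) × (∀ v → (∀ j → x j ≤ v) → u ≤ v)

-- a directed-complete partial order: every non-empty directed subset
-- (given as a directed family) has a least upper bound
record IsDCPO {X : Set} (_≤_ : X → X → Set) : Set₁ where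
  field
    isPartialOrder : IsPartialOrder _≡_ _≤_
    ⋁        : {J : Set} (x : J → X) → IsDirectedFam _≤_ x → X
    ⋁-isLub  : {J : Set} (x : J → X) (d : IsDirectedFam _≤_ x) → IsLub _≤_ x (⋁ x d)

_×≤_ : {X Y : Set} → (X → X → Set) → (Y → Y → Set) → X × Y → X × Y → Set
(_≤X_ ×≤ _≤Y_) p q = (proj₁ p ≤X proj₁ q) × (proj₂ p ≤Y proj₂ q)

-- op : X × Y → Z is continuous w.r.t. the product order: monotone and
-- preserving suprema of directed families (suprema in X × Y are componentwise)
record IsContinuous₂ {X Y Z : Set} (_≤X_ : X → X → Set) (_≤Y_ : Y → Y → Set)
                     (_≤Z_ : Z → Z → Set) (op : X → Y → Z) : Set₁ where
  field
    monotone : ∀ {x x' y y'} → x ≤X x' → y ≤Y y' → op x y ≤Z op x' y'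
    preserves-⋁ : {J : Set} (p : J → X × Y) → IsDirectedFam (_≤X_ ×≤ _≤Y_) p →
                  ∀ u v → IsLub _≤X_ (λ j → proj₁ (p j)) u → IsLub _≤Y_ (λ j → proj₂ (p j)) v →
                  IsLub _≤Z_ (λ j → op (proj₁ (p j)) (proj₂ (p j))) (op u v)

record IsContinuousCA (B : ChangeAction) : Set₁ where
  open ChangeAction B
  field
    _≤_  : Obj B → Obj B → Set
    _≤Δ_ : Δ B → Δ B → Set
    dcpo  : IsDCPO _≤_
    dcpoΔ : IsDCPO _≤Δ_
    ⊕-continuous : IsContinuous₂ _≤_ _≤Δ_ _≤_ _⊕_
    +-continuous : IsContinuous₂ _≤Δ_ _≤Δ_ _≤Δ_ _+_

record DirectedSet : Set₁ where
  field
    Idx   : Set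
    _≼_   : Idx → Idx → Set
    ≼-refl  : ∀ {i} → i ≼ i
    ≼-trans : ∀ {i j k} → i ≼ j → j ≼ k → i ≼ k
    inhabited : Idx
    upper : ∀ i j → Σ Idx λ k → (i ≼ k) × (j ≼ k)

open DirectedSet public using (Idx)

monotone⇒directed : (D : DirectedSet) {X : Set} (_≤_ : X → X → Set) (x : Idx D → X) →
                    (∀ {i j} → DirectedSet._≼_ D i j → x i ≤ x j) → IsDirectedFam _≤_ x
monotone⇒directed D _≤_ x mono =
  DirectedSet.inhabited D ,
  λ j k → let (l , p , q) = DirectedSet.upper D j k in l , mono p , mono q

pointwiseSup : (D : DirectedSet) {S X : Set} {_≤_ : X → X → Set} → IsDCPO _≤_ →
               (f : Idx D → S → X) →
               (∀ {i j} → DirectedSet._≼_ D i j → ∀ s → f i s ≤ f j s) → S → X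
pointwiseSup D {_≤_ = _≤_} dcpo f mono s =
  IsDCPO.⋁ dcpo (λ i → f i s) (monotone⇒directed D _≤_ (λ i → f i s) (λ p → mono p s))

module Submission where

open import Defs
open import Data.Product using (_×_; _,_)
open import Relation.Binary.PropositionalEquality using (_≡_; subst; sym)
open import Relation.Binary.Structures using (IsPartialOrder)

-- Both sides of the derivative condition at (a, δ) are suprema of the same
-- family fᵢ a ⊕ ∂fᵢ (a , δ): the left one because each ∂fᵢ is a derivative,
-- the right one because ⊕ is continuous. Suprema are unique.

IsLub-resp-≗ : {X : Set} (_≤_ : X → X → Set) {J : Set} {x y : J → X} {u : X} →
               (∀ j → x j ≡ y j) → IsLub _≤_ x u → IsLub _≤_ y u
IsLub-resp-≗ _≤_ {u = u} x≗y (upper , least) =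
  (λ j → subst (_≤ u) (x≗y j) (upper j)) ,
  (λ v y≤v → least v (λ j → subst (_≤ v) (sym (x≗y j)) (y≤v j)))

IsLub-unique : {X : Set} {_≤_ : X → X → Set} → IsPartialOrder _≡_ _≤_ →
               {J : Set} {x : J → X} {u v : X} → IsLub _≤_ x u → IsLub _≤_ x v → u ≡ v
IsLub-unique po (u-upper , u-least) (v-upper , v-least) =
  IsPartialOrder.antisym po (u-least _ v-upper) (v-least _ u-upper)

IsLub-⋁ : {X : Set} {_≤_ : X → X → Set} (dcpo : IsDCPO _≤_) (D : DirectedSet)
          (x : Idx D → X) (mono : ∀ {i j} → DirectedSet._≼_ D i j → x i ≤ x j) →
          IsLub _≤_ x (IsDCPO.⋁ dcpo x (monotone⇒directed D _≤_ x mono))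
IsLub-⋁ {_≤_ = _≤_} dcpo D x mono = IsDCPO.⋁-isLub dcpo x (monotone⇒directed D _≤_ x mono)

IsLub-continuous₂ : {X Y Z : Set} {_≤X_ : X → X → Set} {_≤Y_ : Y → Y → Set} {_≤Z_ : Z → Z → Set}
  {op : X → Y → Z} → IsContinuous₂ _≤X_ _≤Y_ _≤Z_ op → (D : DirectedSet)
  {x : Idx D → X} {y : Idx D → Y} {u : X} {v : Y} →
  (∀ {i j} → DirectedSet._≼_ D i j → x i ≤X x j) →
  (∀ {i j} → DirectedSet._≼_ D i j → y i ≤Y y j) →
  IsLub _≤X_ x u → IsLub _≤Y_ y v → IsLub _≤Z_ (λ i → op (x i) (y i)) (op u v)
IsLub-continuous₂ {_≤X_ = _≤X_} {_≤Y_} cont D x-mono y-mono =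
  IsContinuous₂.preserves-⋁ cont _
    (monotone⇒directed D (_≤X_ ×≤ _≤Y_) _ (λ i≼j → x-mono i≼j , y-mono i≼j)) _ _

mainTheorem16 : (A B : ChangeAction) (cB : IsContinuousCA B) (D : DirectedSet)
    (f : Idx D → Obj A → Obj B) (∂f : Idx D → Obj A × Δ A → Δ B)
    (f-mono : ∀ {i j} → DirectedSet._≼_ D i j → ∀ a → IsContinuousCA._≤_ cB (f i a) (f j a))
    (∂f-mono : ∀ {i j} → DirectedSet._≼_ D i j → ∀ p → IsContinuousCA._≤Δ_ cB (∂f i p) (∂f j p)) →
    (∀ i → IsDerivative A B (f i) (λ a δ → ∂f i (a , δ))) →
    IsDerivative A B (pointwiseSup D (IsContinuousCA.dcpo cB) f f-mono)
                     (λ a δ → pointwiseSup D (IsContinuousCA.dcpoΔ cB) ∂f ∂f-mono (a , δ))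
mainTheorem16 A B cB D f ∂f f-mono ∂f-mono ∂f-derivative a δ =
  IsLub-unique (IsDCPO.isPartialOrder dcpo) lub-via-derivatives lub-via-continuity
  where
  open IsContinuousCA cB
  open ChangeAction using (_⊕_)

  lub-via-derivatives : IsLub _≤_ (λ i → _⊕_ B (f i a) (∂f i (a , δ)))
                          (pointwiseSup D dcpo f f-mono (_⊕_ A a δ))
  lub-via-derivatives =
    IsLub-resp-≗ _≤_ (λ i → ∂f-derivative i a δ)
      (IsLub-⋁ dcpo D (λ i → f i (_⊕_ A a δ)) (λ i≼j → f-mono i≼j _))

  lub-via-continuity : IsLub _≤_ (λ i → _⊕_ B (f i a) (∂f i (a , δ)))
                         (_⊕_ B (pointwiseSup D dcpo f f-mono a)
                                (pointwiseSup D dcpoΔ ∂f ∂f-mono (a , δ)))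
  lub-via-continuity =
    IsLub-continuous₂ ⊕-continuous D (λ i≼j → f-mono i≼j a) (λ i≼j → ∂f-mono i≼j (a , δ))
      (IsLub-⋁ dcpo D (λ i → f i a) (λ i≼j → f-mono i≼j a))
      (IsLub-⋁ dcpoΔ D (λ i → ∂f i (a , δ)) (λ i≼j → ∂f-mono i≼j (a , δ)))
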